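{- Let $a,b,c,c'$ be positive integers with $c\le c'$. Then $\mathcal{CG}_2([a,b,c])\subseteq\mathcal{CG}_2([a,b,c'])$, i.e. every contact graph of a configuration from $\mathcal{CC}_2([a,b,c])$ is (isomorphic to) the contact graph of a configuration from $\mathcal{CC}_2([a,b,c'])$.
   Context: For positive integers $p,q,r$ let $\mathcal{CC}_1([p,q,r])=\{[x,x+p]\times[y,y+q]\times[z,z+r]: x,y,z\in\mathbb{Z}\}$ and $\mathcal{CC}_2([a,b,c])=\mathcal{CC}_1([a,b,c])\cup\mathcal{CC}_1([b,a,c])$. A configuration is a finite subset of $\mathcal{CC}_2([a,b,c])$ with pairwise disjoint interiors; two of its cuboids touch if their intersection is a non-degenerate two-dimensional rectangle; its contact graph has the cuboids as vertices and edges between touching cuboids. $\mathcal{CG}_2([a,b,c])$ is the class of all such contact graphs. -}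

module Defs where

open import Data.Nat using (ℕ)
open import Data.Integer using (ℤ; +_; _+_; _≤_; _<_)
open import Data.Bool using (Bool; true; false)
open import Data.Fin using (Fin)
open import Data.Product using (_×_; Σ; ∃; _,_; proj₁)
open import Data.Sum using (_⊎_)
open import Relation.Nullary using (¬_)
open import Relation.Binary.PropositionalEquality using (_≡_)
open import Function.Bundles using (_⤖_; _⇔_; Bijection)

-- A cuboid of CC_2([a,b,c]): lower corner (x,y,z) ∈ ℤ³ and an orientation.
-- orientation false : [x,x+a]×[y,y+b]×[z,z+c]   (element of CC_1([a,b,c]))
-- orientation true  : [x,x+b]×[y,y+a]×[z,z+c]   (element of CC_1([b,a,c]))
record Cuboid : Set where
  constructor cuboid
  field
    x y z  : ℤ
    rot    : Bool
open Cuboid public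

lenX : ℕ → ℕ → Cuboid → ℤ
lenX a b C with rot C
... | false = + a
... | true  = + b

lenY : ℕ → ℕ → Cuboid → ℤ
lenY a b C with rot C
... | false = + b
... | true  = + a

lenZ : ℕ → Cuboid → ℤ
lenZ c C = + c

IntDisj : ℤ → ℤ → ℤ → ℤ → Set
IntDisj s l t m = (s + l ≤ t) ⊎ (t + m ≤ s)

IntOverlap : ℤ → ℤ → ℤ → ℤ → Set
IntOverlap s l t m = (s < t + m) × (t < s + l)

IntAbut : ℤ → ℤ → ℤ → ℤ → Set
IntAbut s l t m = (s + l ≡ t) ⊎ (t + m ≡ s)

-- Two axis-parallel boxes have disjoint interiors iff they are separated in some axis.
InteriorDisjoint : ℕ → ℕ → ℕ → Cuboid → Cuboid → Set
InteriorDisjoint a b c C D =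
  IntDisj (x C) (lenX a b C) (x D) (lenX a b D)
  ⊎ IntDisj (y C) (lenY a b C) (y D) (lenY a b D)
  ⊎ IntDisj (z C) (lenZ c C) (z D) (lenZ c D)

-- Touching: intersection is a non-degenerate 2-dimensional rectangle, i.e.
-- in one axis the intervals meet in a single point and in the other two
-- axes they overlap with positive length.
Touch : ℕ → ℕ → ℕ → Cuboid → Cuboid → Set
Touch a b c C D =
    (IntAbut (x C) (lenX a b C) (x D) (lenX a b D)
      × IntOverlap (y C) (lenY a b C) (y D) (lenY a b D)
      × IntOverlap (z C) (lenZ c C) (z D) (lenZ c D))
  ⊎ (IntOverlap (x C) (lenX a b C) (x D) (lenX a b D)
      × IntAbut (y C) (lenY a b C) (y D) (lenY a b D)
      × IntOverlap (z C) (lenZ c C) (z D) (lenZ c D))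
  ⊎ (IntOverlap (x C) (lenX a b C) (x D) (lenX a b D)
      × IntOverlap (y C) (lenY a b C) (y D) (lenY a b D)
      × IntAbut (z C) (lenZ c C) (z D) (lenZ c D))

-- A configuration of n cuboids from CC_2([a,b,c]), enumerated by Fin n,
-- with pairwise disjoint interiors (hence pairwise distinct as sets).
Configuration : ℕ → ℕ → ℕ → ℕ → Set
Configuration a b c n =
  Σ (Fin n → Cuboid) λ C →
    (i j : Fin n) → ¬ (i ≡ j) → InteriorDisjoint a b c (C i) (C j)

ContactAdj : ∀ {a b c n} → Configuration a b c n → Fin n → Fin n → Set
ContactAdj {a} {b} {c} (C , _) i j = Touch a b c (C i) (C j)

GraphIso : ∀ {n m} → (Fin n → Fin n → Set) → (Fin m → Fin m → Set) → Set
GraphIso {n} {m} E F =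
  Σ (Fin n ⤖ Fin m) λ σ →
    (i j : Fin n) → E i j ⇔ F (Bijection.to σ i) (Bijection.to σ j)

InCG₂ : ℕ → ℕ → ℕ → {n : ℕ} → (Fin n → Fin n → Set) → Set
InCG₂ a b c {n} E = ∃ λ m → Σ (Configuration a b c m) λ K → GraphIso E (ContactAdj K)

{-# OPTIONS --safe #-}
module Submission where

-- Stretch the z-axis by  q c + r ↦ q c′ + r  (0 ≤ r < c), leaving x, y and the
-- orientation alone. Integers q d + r with 0 ≤ r < d are ordered lexicographically
-- in (q, r) whatever d is, so as c ≤ c′ the stretch is strictly increasing; and it
-- sends z + c to (its image) + c′. Such a map preserves and reflects every relation
-- between the z-intervals [s, s + c] and [t, t + c] that occurs in the definitions of
-- disjoint interiors and of touching, so the configuration keeps its contact graph.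

open import Defs
open import Data.Nat using (ℕ; _≤_; NonZero)
open import Data.Fin using (Fin)

import Data.Nat as ℕ
import Data.Nat.Properties as ℕ
open import Data.Integer as ℤ using (ℤ; +_; +<+; _+_; _*_; _<_)
open import Data.Integer.Properties
  using (<-cmp; <-irrefl; <-asym; <⇒≢; ≮⇒≥; ≤⇒≯; ≤-refl; +-assoc; +-comm; +-monoˡ-<;
         suc-*; *-monoʳ-≤-nonNeg; i<j⇒suc[i]≤j; i≤j⇒i≤k+j)
open import Data.Integer.DivMod using (_/ℕ_; _%ℕ_; a≡a%ℕn+[a/ℕn]*n; n%ℕd<d)
open import Data.Empty using (⊥-elim)
open import Data.Product using (_×_; _,_)
open import Data.Product.Function.NonDependent.Propositional using (_×-⇔_)
open import Data.Product.Relation.Binary.Lex.Strict using (×-Lex; ×-compare)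
open import Data.Product.Relation.Binary.Pointwise.NonDependent using (Pointwise; ≡×≡⇒≡)
open import Data.Sum as Sum using (inj₁; inj₂)
open import Data.Sum.Function.Propositional using (_⊎-⇔_)
open import Level using (0ℓ)
open import Function using (_∘_; _⇔_; mk⇔; Bijection)
open import Function.Construct.Composition using (_⇔-∘_)
open import Function.Construct.Identity using (⇔-id)
open import Relation.Binary using (Rel; Trichotomous; _Preserves_⟶_; tri<; tri≈; tri>)
open import Relation.Binary.PropositionalEquality
  using (_≡_; refl; sym; trans; cong; subst; subst₂; module ≡-Reasoning)

fromDivMod : ℕ → ℤ × ℕ → ℤ
fromDivMod d (q , r) = + r + q * + d

_<ₗₑₓ_ : Rel (ℤ × ℕ) 0ℓ
_<ₗₑₓ_ = ×-Lex _≡_ _<_ ℕ._<_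

<ₗₑₓ-cmp : Trichotomous (Pointwise _≡_ _≡_) _<ₗₑₓ_
<ₗₑₓ-cmp = ×-compare sym <-cmp ℕ.<-cmp

module _ {d : ℕ} where

  fromDivMod-mono-< : ∀ {q₁ r₁ q₂ r₂} → r₁ ℕ.< d →
                      (q₁ , r₁) <ₗₑₓ (q₂ , r₂) → fromDivMod d (q₁ , r₁) < fromDivMod d (q₂ , r₂)
  fromDivMod-mono-< {q₁} {r₁} {q₂} {r₂} r₁<d (inj₁ q₁<q₂) = begin-strict
    + r₁ + q₁ * + d   <⟨ +-monoˡ-< (q₁ * + d) (+<+ r₁<d) ⟩
    + d + q₁ * + d    ≡⟨ sym (suc-* q₁ (+ d)) ⟩
    ℤ.suc q₁ * + d    ≤⟨ *-monoʳ-≤-nonNeg (+ d) (i<j⇒suc[i]≤j q₁<q₂) ⟩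
    q₂ * + d          ≤⟨ i≤j⇒i≤k+j (+ r₂) ≤-refl ⟩
    + r₂ + q₂ * + d   ∎
    where open Data.Integer.Properties.≤-Reasoning
  fromDivMod-mono-< {q₁} _ (inj₂ (refl , r₁<r₂)) = +-monoˡ-< (q₁ * + d) (+<+ r₁<r₂)

  fromDivMod-cancel-< : ∀ {q₁ r₁ q₂ r₂} → r₁ ℕ.< d → r₂ ℕ.< d →
                        fromDivMod d (q₁ , r₁) < fromDivMod d (q₂ , r₂) → (q₁ , r₁) <ₗₑₓ (q₂ , r₂)
  fromDivMod-cancel-< {q₁} {r₁} {q₂} {r₂} _ r₂<d lt with <ₗₑₓ-cmp (q₁ , r₁) (q₂ , r₂)
  ... | tri< x<y _ _ = x<y
  ... | tri≈ _ x≡y _ = ⊥-elim (<-irrefl (cong (fromDivMod d) (≡×≡⇒≡ x≡y)) lt)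
  ... | tri> _ _ y<x = ⊥-elim (<-asym lt (fromDivMod-mono-< r₂<d y<x))

  fromDivMod-injective : ∀ {q₁ r₁ q₂ r₂} → r₁ ℕ.< d → r₂ ℕ.< d →
                         fromDivMod d (q₁ , r₁) ≡ fromDivMod d (q₂ , r₂) → (q₁ , r₁) ≡ (q₂ , r₂)
  fromDivMod-injective {q₁} {r₁} {q₂} {r₂} r₁<d r₂<d eq with <ₗₑₓ-cmp (q₁ , r₁) (q₂ , r₂)
  ... | tri< x<y _ _ = ⊥-elim (<⇒≢ (fromDivMod-mono-< r₁<d x<y) eq)
  ... | tri≈ _ x≡y _ = ≡×≡⇒≡ x≡y
  ... | tri> _ _ y<x = ⊥-elim (<⇒≢ (fromDivMod-mono-< r₂<d y<x) (sym eq))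

  fromDivMod-+ : ∀ q r → fromDivMod d (q , r) + + d ≡ fromDivMod d (ℤ.suc q , r)
  fromDivMod-+ q r = begin
    + r + q * + d + + d    ≡⟨ +-assoc (+ r) (q * + d) (+ d) ⟩
    + r + (q * + d + + d)  ≡⟨ cong (_+_ (+ r)) (+-comm (q * + d) (+ d)) ⟩
    + r + (+ d + q * + d)  ≡⟨ cong (_+_ (+ r)) (sym (suc-* q (+ d))) ⟩
    + r + ℤ.suc q * + d    ∎
    where open ≡-Reasoning

module _ (c : ℕ) .{{_ : NonZero c}} where

  divMod : ℤ → ℤ × ℕ
  divMod z = z /ℕ c , z %ℕ c

  fromDivMod-divMod : ∀ z → fromDivMod c (divMod z) ≡ z
  fromDivMod-divMod z = sym (a≡a%ℕn+[a/ℕn]*n z c)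

  divMod-strictMono : divMod Preserves _<_ ⟶ _<ₗₑₓ_
  divMod-strictMono {z₁} {z₂} z₁<z₂ = fromDivMod-cancel-< {c} (n%ℕd<d z₁ c) (n%ℕd<d z₂ c)
    (subst₂ _<_ (sym (fromDivMod-divMod z₁)) (sym (fromDivMod-divMod z₂)) z₁<z₂)

  divMod-+ : ∀ z → divMod (z + + c) ≡ (ℤ.suc (z /ℕ c) , z %ℕ c)
  divMod-+ z = fromDivMod-injective (n%ℕd<d (z + + c) c) (n%ℕd<d z c) (begin
    fromDivMod c (divMod (z + + c))         ≡⟨ fromDivMod-divMod (z + + c) ⟩
    z + + c                                 ≡⟨ cong (_+ + c) (sym (fromDivMod-divMod z)) ⟩
    fromDivMod c (divMod z) + + c           ≡⟨ fromDivMod-+ (z /ℕ c) (z %ℕ c) ⟩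
    fromDivMod c (ℤ.suc (z /ℕ c) , z %ℕ c)  ∎)
    where open ≡-Reasoning

  module _ (c′ : ℕ) where

    stretch : ℤ → ℤ
    stretch z = fromDivMod c′ (divMod z)

    stretch-strictMono : c ≤ c′ → stretch Preserves _<_ ⟶ _<_
    stretch-strictMono c≤c′ {z₁} z₁<z₂ =
      fromDivMod-mono-< {c′} (ℕ.<-≤-trans (n%ℕd<d z₁ c) c≤c′) (divMod-strictMono z₁<z₂)

    stretch-+ : ∀ z → stretch (z + + c) ≡ stretch z + + c′
    stretch-+ z = trans (cong (fromDivMod c′) (divMod-+ z)) (sym (fromDivMod-+ (z /ℕ c) (z %ℕ c)))

module _ {f : ℤ → ℤ} (f-strictMono : f Preserves _<_ ⟶ _<_) where

  strictMono⇒cancel-< : ∀ {s t} → f s < f t → s < t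
  strictMono⇒cancel-< {s} {t} fs<ft with <-cmp s t
  ... | tri< s<t _ _ = s<t
  ... | tri≈ _ refl _ = ⊥-elim (<-irrefl refl fs<ft)
  ... | tri> _ _ t<s = ⊥-elim (<-asym fs<ft (f-strictMono t<s))

  strictMono⇒mono : f Preserves ℤ._≤_ ⟶ ℤ._≤_
  strictMono⇒mono s≤t = ≮⇒≥ (≤⇒≯ s≤t ∘ strictMono⇒cancel-<)

  strictMono⇒injective : ∀ {s t} → f s ≡ f t → s ≡ t
  strictMono⇒injective {s} {t} fs≡ft with <-cmp s t
  ... | tri< s<t _ _ = ⊥-elim (<⇒≢ (f-strictMono s<t) fs≡ft)
  ... | tri≈ _ s≡t _ = s≡t
  ... | tri> _ _ t<s = ⊥-elim (<⇒≢ (f-strictMono t<s) (sym fs≡ft))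

  module _ {l l′ : ℤ} (f-+ : ∀ z → f (z + l) ≡ f z + l′) where

    +≤-map : ∀ {s t} → s + l ℤ.≤ t → f s + l′ ℤ.≤ f t
    +≤-map {s} {t} s+l≤t = subst (ℤ._≤ f t) (f-+ s) (strictMono⇒mono s+l≤t)

    <+-⇔ : ∀ {s t} → s < t + l ⇔ f s < f t + l′
    <+-⇔ {s} {t} = mk⇔
      (λ s<t+l → subst (f s <_) (f-+ t) (f-strictMono s<t+l))
      (λ fs<ft+l′ → strictMono⇒cancel-< (subst (f s <_) (sym (f-+ t)) fs<ft+l′))

    +≡-⇔ : ∀ {s t} → s + l ≡ t ⇔ f s + l′ ≡ f t
    +≡-⇔ {s} = mk⇔
      (λ s+l≡t → trans (sym (f-+ s)) (cong f s+l≡t))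
      (λ fs+l′≡ft → strictMono⇒injective (trans (f-+ s) fs+l′≡ft))

    IntDisj-map : ∀ {s t} → IntDisj s l t l → IntDisj (f s) l′ (f t) l′
    IntDisj-map = Sum.map +≤-map +≤-map

    IntOverlap-⇔ : ∀ {s t} → IntOverlap s l t l ⇔ IntOverlap (f s) l′ (f t) l′
    IntOverlap-⇔ = <+-⇔ ×-⇔ <+-⇔

    IntAbut-⇔ : ∀ {s t} → IntAbut s l t l ⇔ IntAbut (f s) l′ (f t) l′
    IntAbut-⇔ = +≡-⇔ ⊎-⇔ +≡-⇔

mapZ : (ℤ → ℤ) → Cuboid → Cuboid
mapZ f C = record C { z = f (z C) }

module _ {c c′ : ℕ} {f : ℤ → ℤ} (f-strictMono : f Preserves _<_ ⟶ _<_)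
         (f-+ : ∀ z → f (z + + c) ≡ f z + + c′) (a b : ℕ) where

  InteriorDisjoint-mapZ : ∀ C D → InteriorDisjoint a b c C D →
                          InteriorDisjoint a b c′ (mapZ f C) (mapZ f D)
  InteriorDisjoint-mapZ C D = Sum.map₂ (Sum.map₂ (IntDisj-map f-strictMono f-+))

  Touch-mapZ : ∀ C D → Touch a b c C D ⇔ Touch a b c′ (mapZ f C) (mapZ f D)
  Touch-mapZ C D =
    ⇔-id _ ×-⇔ ⇔-id _ ×-⇔ overlapping ⊎-⇔
    ⇔-id _ ×-⇔ ⇔-id _ ×-⇔ overlapping ⊎-⇔
    ⇔-id _ ×-⇔ ⇔-id _ ×-⇔ IntAbut-⇔ f-strictMono f-+
    where overlapping = IntOverlap-⇔ f-strictMono f-+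

module _ {a b c a′ b′ c′ : ℕ} (g : Cuboid → Cuboid)
         (g-disjoint : ∀ C D → InteriorDisjoint a b c C D → InteriorDisjoint a′ b′ c′ (g C) (g D))
         (g-touch : ∀ C D → Touch a b c C D ⇔ Touch a′ b′ c′ (g C) (g D)) where

  Configuration-map : ∀ {m} → Configuration a b c m → Configuration a′ b′ c′ m
  Configuration-map (C , disjoint) = g ∘ C , λ i j i≢j → g-disjoint (C i) (C j) (disjoint i j i≢j)

  InCG₂-map : ∀ {n} {E : Fin n → Fin n → Set} → InCG₂ a b c E → InCG₂ a′ b′ c′ E
  InCG₂-map (m , K@(C , _) , σ , E≅K) =
    m , Configuration-map K , σ , λ i j → g-touch (C (to σ i)) (C (to σ j)) ⇔-∘ E≅K i j
    where open Bijection using (to)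

lemma4p7 : (a b c c' : ℕ) → .{{_ : NonZero a}} → .{{_ : NonZero b}} → .{{_ : NonZero c}} → .{{_ : NonZero c'}} →
    c ≤ c' → {n : ℕ} → (E : Fin n → Fin n → Set) → InCG₂ a b c E → InCG₂ a b c' E
lemma4p7 a b c c' c≤c' _ =
  InCG₂-map (mapZ (stretch c c'))
    (InteriorDisjoint-mapZ (stretch-strictMono c c' c≤c') (stretch-+ c c') a b)
    (Touch-mapZ (stretch-strictMono c c' c≤c') (stretch-+ c c') a b)
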